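{- Let $G\in\mathscr{G}_{a,b}$ and let $P=u_0u_1\ldots u_k$ be an internal path or an internal cycle in $G$. Then: (i) $k\le 3$; (ii) if $k=3$, then there is no internal path $v_0v_1v_2$ of length $2$ in $G$ with $d_G(v_0)=d_G(v_2)=d_G(u_0)$; (iii) if $k=3$, then $d_G(u_0)=d_G(u_3)$; moreover, if there exists another internal path $v_0v_1v_2v_3$ (of length 3) in $G$, then $d_G(v_0)=d_G(v_3)=d_G(u_0)=d_G(u_3)$.
   Context: All graphs are finite, simple, connected, with at least one edge; $d_G(v)$ is the degree of $v$ and $N_G(v)$ its neighbourhood. For integers $a,b$, $\mathscr{G}_{a,b}$ denotes the set of such graphs $G$ for which $(a,b)$ is the unique pair of integers such that $\sum_{u\in N_G(v)}d_G(u)=a\,d_G(v)+b-d_G(v)^2$ for every $v\in V_G$. A path (or closed walk) $u_0u_1\ldots u_k$ with $k\ge1$ is called an internal path if $u_0\neq u_k$, $d_G(u_0),d_G(u_k)\ge 3$ and $d_G(u_i)=2$ for $1\le i\le k-1$; it is called an internal cycle if $u_0=u_k$, $k\ge 3$, $d_G(u_0)\ge3$, $d_G(u_i)=2$ for $1\le i\le k-1$ and $u_0,\dots,u_{k-1}$ are distinct. -}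

module Defs where

open import Data.Nat using (ℕ; zero; suc; _≤_; _<_)
open import Data.Fin using (Fin; toℕ; inject₁; fromℕ) renaming (suc to fsuc; zero to fzero)
open import Data.List using (List; map; allFin)
open import Data.Nat.ListAction using (sum)
open import Data.Bool using (Bool; true; false; if_then_else_)
open import Data.Integer as ℤ using (ℤ; +_)
open import Data.Product using (Σ; _×_; ∃-syntax)
open import Relation.Binary.PropositionalEquality using (_≡_; _≢_)
open import Relation.Nullary using (¬_)

record Graph : Set where
  field
    n      : ℕ
    adj    : Fin n → Fin n → Bool
    symm   : ∀ u v → adj u v ≡ adj v u
    irrefl : ∀ v → adj v v ≡ false

module _ (G : Graph) where
  open Graph G

  Vertex : Set
  Vertex = Fin n

  Adj : Vertex → Vertex → Set
  Adj u v = adj u v ≡ true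

  deg : Vertex → ℕ
  deg v = sum (map (λ u → if adj v u then 1 else 0) (allFin n))

  nbrDegSum : Vertex → ℕ
  nbrDegSum v = sum (map (λ u → if adj v u then deg u else 0) (allFin n))

  data Reach : Vertex → Vertex → Set where
    here : ∀ {v} → Reach v v
    step : ∀ {u w v} → Adj u w → Reach w v → Reach u v

  Connected : Set
  Connected = ∀ u v → Reach u v

  HasEdge : Set
  HasEdge = Σ Vertex λ u → Σ Vertex λ v → Adj u v

  SatisfiesAB : ℤ → ℤ → Set
  SatisfiesAB a b = ∀ v →
    + nbrDegSum v ≡ (a ℤ.* + deg v ℤ.+ b) ℤ.- (+ deg v ℤ.* + deg v)

  InClass : ℤ → ℤ → Set
  InClass a b = Connected × HasEdge × SatisfiesAB a b ×
                (∀ a' b' → SatisfiesAB a' b' → (a' ≡ a) × (b' ≡ b))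

  Seq : ℕ → Set
  Seq k = Fin (suc k) → Vertex

  first : ∀ {k} → Seq k → Vertex
  first u = u fzero

  last : ∀ {k} → Seq k → Vertex
  last {k} u = u (fromℕ k)

  ConsecAdj : ∀ {k} → Seq k → Set
  ConsecAdj {k} u = ∀ (i : Fin k) → Adj (u (inject₁ i)) (u (fsuc i))

  InteriorDeg2 : ∀ {k} → Seq k → Set
  InteriorDeg2 {k} u = ∀ (i : Fin (suc k)) → 0 < toℕ i → toℕ i < k → deg (u i) ≡ 2

  IsInternalPath : (k : ℕ) → Seq k → Set
  IsInternalPath k u =
    1 ≤ k × ConsecAdj u ×
    (∀ i j → u i ≡ u j → i ≡ j) ×
    first u ≢ last u ×
    3 ≤ deg (first u) × 3 ≤ deg (last u) ×
    InteriorDeg2 u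

  IsInternalCycle : (k : ℕ) → Seq k → Set
  IsInternalCycle k u =
    3 ≤ k × ConsecAdj u ×
    first u ≡ last u ×
    3 ≤ deg (first u) ×
    InteriorDeg2 u ×
    (∀ i j → toℕ i < k → toℕ j < k → u i ≡ u j → i ≡ j)

-- A degree-2 vertex w with neighbours x and y has neighbour-degree sum
-- d(x) + d(y), and the defining identity of 𝒢_{a,b} makes this sum depend
-- only on d(w) = 2.  So d(x) + d(y) = s is the same constant for every
-- degree-2 vertex.  Along an internal path or cycle u₀u₁u₂u₃… the vertices
-- u₁ and u₂ give d(u₀) + 2 = s = 2 + d(u₃): hence d(u₀) = d(u₃) = s − 2,
-- which excludes d(u₃) = 2 (so k ≤ 3) and pins down the end degrees of every
-- internal path of length 3, while an internal path v₀v₁v₂ with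
-- d(v₀) = d(v₂) = d(u₀) would give s = 2 d(u₀), i.e. d(u₀) = 2.
module Submission where

open import Defs
open import Data.Bool using (Bool; true; false; if_then_else_)
open import Data.Empty using (⊥-elim)
open import Data.Fin using (Fin; zero; suc; _≟_)
open import Data.Fin.Patterns using (0F; 1F; 2F; 3F)
open import Data.Integer as ℤ using (ℤ)
open import Data.Integer.Properties using (+-injective)
open import Data.List using (map; allFin; tabulate)
open import Data.List.Properties using (map-tabulate)
open import Data.Nat using (ℕ; zero; suc; _+_; _≤_; z≤n; s≤s; z<s; s<s)
open import Data.Nat.ListAction using (sum)
open import Data.Nat.Properties
  using (+-0-monoid; +-commutativeSemigroup; +-comm; +-identityʳ; +-cancelˡ-≡; +-cancelʳ-≡; m+n≡0⇒m≡0; m+n≡0⇒n≡0; n≮n)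
open import Data.Product using (Σ; _×_; _,_)
open import Data.Sum using (_⊎_; inj₁; inj₂)
open import Data.Vec.Functional using (Vector; updateAt)
open import Data.Vec.Functional.Properties using (updateAt-updates; updateAt-minimal)
open import Function using (_∘_; id; const; case_of_)
open import Relation.Binary.PropositionalEquality
  using (_≡_; _≢_; _≗_; refl; sym; trans; cong; cong₂; subst; module ≡-Reasoning)
open import Relation.Nullary using (¬_; yes; no)

open import Algebra.Properties.CommutativeSemigroup +-commutativeSemigroup using (x∙yz≈y∙xz)
open import Algebra.Properties.Monoid.Sum +-0-monoid using (sum-cong-≗; sum-replicate-zero) renaming (sum to ∑)

sum-map-allFin : ∀ {n} (h : Vector ℕ n) → sum (map h (allFin n)) ≡ ∑ h
sum-map-allFin h = trans (cong sum (map-tabulate id h)) (sum-tabulate h)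
  where
  sum-tabulate : ∀ {n} (h : Vector ℕ n) → sum (tabulate h) ≡ ∑ h
  sum-tabulate {zero} h = refl
  sum-tabulate {suc n} h = cong (h zero +_) (sum-tabulate (h ∘ suc))

∑-updateAt-zero : ∀ {n} (h : Vector ℕ n) i → ∑ h ≡ h i + ∑ (updateAt h i (const 0))
∑-updateAt-zero h zero = refl
∑-updateAt-zero h (suc i) = begin
  h 0F + ∑ (h ∘ suc)                                        ≡⟨ cong (h 0F +_) (∑-updateAt-zero (h ∘ suc) i) ⟩
  h 0F + (h (suc i) + ∑ (updateAt (h ∘ suc) i (const 0)))  ≡⟨ x∙yz≈y∙xz (h 0F) (h (suc i)) _ ⟩
  h (suc i) + (h 0F + ∑ (updateAt (h ∘ suc) i (const 0)))  ∎
  where open ≡-Reasoning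

select : ∀ {n} → Vector Bool n → Vector ℕ n → Vector ℕ n
select p f i = if p i then f i else 0

count : ∀ {n} → Vector Bool n → ℕ
count p = ∑ (select p (const 1))

deselect : ∀ {n} → Vector Bool n → Fin n → Vector Bool n
deselect p i = updateAt p i (const false)

select-deselect : ∀ {n} (p : Vector Bool n) f i →
                  select (deselect p i) f ≗ updateAt (select p f) i (const 0)
select-deselect p f i j with j ≟ i
... | yes refl = begin
  (if updateAt p i (const false) i then f i else 0)  ≡⟨ cong (λ b → if b then f i else 0) (updateAt-updates i p) ⟩
  0                                                  ≡⟨ updateAt-updates i (select p f) ⟨
  updateAt (select p f) i (const 0) i                ∎
  where open ≡-Reasoning
... | no j≢i = begin
  (if updateAt p i (const false) j then f j else 0)  ≡⟨ cong (λ b → if b then f j else 0) (updateAt-minimal j i p j≢i) ⟩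
  select p f j                                       ≡⟨ updateAt-minimal j i (select p f) j≢i ⟨
  updateAt (select p f) i (const 0) j                ∎
  where open ≡-Reasoning

∑-select-deselect : ∀ {n} (p : Vector Bool n) f {i} → p i ≡ true →
                    ∑ (select p f) ≡ f i + ∑ (select (deselect p i) f)
∑-select-deselect p f {i} pi = begin
  ∑ (select p f)                                     ≡⟨ ∑-updateAt-zero (select p f) i ⟩
  select p f i + ∑ (updateAt (select p f) i (const 0)) ≡⟨ cong₂ _+_ (cong (λ b → if b then f i else 0) pi)
                                                                     (sym (sum-cong-≗ (select-deselect p f i))) ⟩
  f i + ∑ (select (deselect p i) f)                  ∎
  where open ≡-Reasoning

count≡0⇒none : ∀ {n} (p : Vector Bool n) → count p ≡ 0 → ∀ i → p i ≡ false
count≡0⇒none p c≡0 zero = indicator≡0 (p 0F) (m+n≡0⇒m≡0 _ c≡0)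
  where
  indicator≡0 : ∀ b → (if b then 1 else 0) ≡ 0 → b ≡ false
  indicator≡0 true  ()
  indicator≡0 false _ = refl
count≡0⇒none p c≡0 (suc i) = count≡0⇒none (p ∘ suc) (m+n≡0⇒n≡0 (select p (const 1) 0F) c≡0) i

∑-select-none : ∀ {n} (p : Vector Bool n) f → (∀ i → p i ≡ false) → ∑ (select p f) ≡ 0
∑-select-none {n} p f none =
  trans (sum-cong-≗ (λ i → cong (λ b → if b then f i else 0) (none i))) (sum-replicate-zero n)

∑-select-pair : ∀ {n} (p : Vector Bool n) f {x y} → count p ≡ 2 →
                p x ≡ true → p y ≡ true → x ≢ y → ∑ (select p f) ≡ f x + f y
∑-select-pair p f {x} {y} count≡2 px py x≢y = begin
  ∑ (select p f)                  ≡⟨ ∑-select-deselect p f px ⟩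
  f x + ∑ (select p′ f)           ≡⟨ cong (f x +_) (∑-select-deselect p′ f p′y) ⟩
  f x + (f y + ∑ (select q f))    ≡⟨ cong (λ r → f x + (f y + r)) (∑-select-none q f (count≡0⇒none q count-q≡0)) ⟩
  f x + (f y + 0)                 ≡⟨ cong (f x +_) (+-identityʳ (f y)) ⟩
  f x + f y                       ∎
  where
  open ≡-Reasoning
  p′ q : Vector Bool _
  p′ = deselect p x
  q  = deselect p′ y
  p′y : p′ y ≡ true
  p′y = trans (updateAt-minimal y x p (x≢y ∘ sym)) py
  count-p′≡1 : count p′ ≡ 1
  count-p′≡1 = +-cancelˡ-≡ 1 _ _ (trans (sym (∑-select-deselect p (const 1) px)) count≡2)
  count-q≡0 : count q ≡ 0
  count-q≡0 = +-cancelˡ-≡ 1 _ _ (trans (sym (∑-select-deselect p′ (const 1) p′y)) count-p′≡1)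

module _ (G : Graph) where
  open Graph G

  record Wedge (x w y : Vertex G) : Set where
    field
      adjˡ     : Adj G w x
      adjʳ     : Adj G w y
      distinct : x ≢ y
      deg≡2    : deg G w ≡ 2

  nbrDegSum-wedge : ∀ {x w y} → Wedge x w y → nbrDegSum G w ≡ deg G x + deg G y
  nbrDegSum-wedge {w = w} W = begin
    nbrDegSum G w                 ≡⟨ sum-map-allFin (select (adj w) (deg G)) ⟩
    ∑ (select (adj w) (deg G))    ≡⟨ ∑-select-pair (adj w) (deg G) count≡2 adjˡ adjʳ distinct ⟩
    deg G _ + deg G _             ∎
    where
    open ≡-Reasoning
    open Wedge W
    count≡2 : count (adj w) ≡ 2
    count≡2 = trans (sym (sum-map-allFin (select (adj w) (const 1)))) deg≡2

  nbrDegSum-by-deg : ∀ a b → SatisfiesAB G a b → ∀ {v w} → deg G v ≡ deg G w →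
                     nbrDegSum G v ≡ nbrDegSum G w
  nbrDegSum-by-deg a b sat {v} {w} dv≡dw =
    +-injective (trans (sat v) (trans (cong rhs dv≡dw) (sym (sat w))))
    where
    rhs : ℕ → ℤ
    rhs d = (a ℤ.* ℤ.+ d ℤ.+ b) ℤ.- (ℤ.+ d ℤ.* ℤ.+ d)

  wedge-outer-deg-sum : ∀ a b → SatisfiesAB G a b → ∀ {x w y x′ w′ y′} →
                        Wedge x w y → Wedge x′ w′ y′ → deg G x + deg G y ≡ deg G x′ + deg G y′
  wedge-outer-deg-sum a b sat W W′ =
    trans (sym (nbrDegSum-wedge W))
          (trans (nbrDegSum-by-deg a b sat (trans (Wedge.deg≡2 W) (sym (Wedge.deg≡2 W′))))
                 (nbrDegSum-wedge W′))

  Adj-sym : ∀ {v w} → Adj G v w → Adj G w v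
  Adj-sym {v} {w} = trans (symm w v)

  Internal : (k : ℕ) → Seq G k → Set
  Internal k u = IsInternalPath G k u ⊎ IsInternalCycle G k u

  internal-consecAdj : ∀ {k u} → Internal k u → ConsecAdj G u
  internal-consecAdj (inj₁ (_ , adj , _)) = adj
  internal-consecAdj (inj₂ (_ , adj , _)) = adj

  internal-interiorDeg2 : ∀ {k u} → Internal k u → InteriorDeg2 G u
  internal-interiorDeg2 (inj₁ (_ , _ , _ , _ , _ , _ , deg2)) = deg2
  internal-interiorDeg2 (inj₂ (_ , _ , _ , _ , deg2 , _)) = deg2

  internal-deg-first : ∀ {k u} → Internal k u → 3 ≤ deg G (first G u)
  internal-deg-first (inj₁ (_ , _ , _ , _ , deg≥3 , _)) = deg≥3
  internal-deg-first (inj₂ (_ , _ , _ , deg≥3 , _)) = deg≥3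

  internal-deg-first≢2 : ∀ {k u} → Internal k u → deg G (first G u) ≢ 2
  internal-deg-first≢2 I d≡2 = n≮n 2 (subst (3 ≤_) d≡2 (internal-deg-first I))

  internal-u₀≢u₂ : ∀ {m} {u : Seq G (2 + m)} → Internal (2 + m) u → u 0F ≢ u 2F
  internal-u₀≢u₂ (inj₁ (_ , _ , inj , _)) = (λ ()) ∘ inj 0F 2F
  internal-u₀≢u₂ (inj₂ (3≤k , _ , _ , _ , _ , inj)) = (λ ()) ∘ inj 0F 2F z<s 3≤k

  internal-u₁≢u₃ : ∀ m {u : Seq G (3 + m)} → Internal (3 + m) u → u 1F ≢ u 3F
  internal-u₁≢u₃ m (inj₁ (_ , _ , inj , _)) = (λ ()) ∘ inj 1F 3F
  internal-u₁≢u₃ zero (inj₂ (_ , _ , u₀≡u₃ , _ , _ , inj)) u₁≡u₃ =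
    case inj 1F 0F (s<s z<s) z<s (trans u₁≡u₃ (sym u₀≡u₃)) of λ ()
  internal-u₁≢u₃ (suc m) (inj₂ (_ , _ , _ , _ , _ , inj)) =
    (λ ()) ∘ inj 1F 3F (s<s z<s) (s<s (s<s (s<s z<s)))

  internal-wedge₀ : ∀ {m} {u : Seq G (2 + m)} → Internal (2 + m) u → Wedge (u 0F) (u 1F) (u 2F)
  internal-wedge₀ I = record
    { adjˡ     = Adj-sym (internal-consecAdj I 0F)
    ; adjʳ     = internal-consecAdj I 1F
    ; distinct = internal-u₀≢u₂ I
    ; deg≡2    = internal-interiorDeg2 I 1F z<s (s<s z<s)
    }

  internal-wedge₁ : ∀ {m} {u : Seq G (3 + m)} → Internal (3 + m) u → Wedge (u 1F) (u 2F) (u 3F)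
  internal-wedge₁ {m} I = record
    { adjˡ     = Adj-sym (internal-consecAdj I 1F)
    ; adjʳ     = internal-consecAdj I 2F
    ; distinct = internal-u₁≢u₃ m I
    ; deg≡2    = internal-interiorDeg2 I 2F z<s (s<s (s<s z<s))
    }

  module _ (a b : ℤ) (sat : SatisfiesAB G a b) where

    internal-deg₀≡deg₃ : ∀ {m} {u : Seq G (3 + m)} → Internal (3 + m) u → deg G (u 0F) ≡ deg G (u 3F)
    internal-deg₀≡deg₃ {u = u} I = +-cancelʳ-≡ 2 _ _ (begin
      deg G (u 0F) + 2             ≡⟨ cong (deg G (u 0F) +_) (sym (Wedge.deg≡2 W₁)) ⟩
      deg G (u 0F) + deg G (u 2F)  ≡⟨ wedge-outer-deg-sum a b sat W₀ W₁ ⟩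
      deg G (u 1F) + deg G (u 3F)  ≡⟨ cong (_+ deg G (u 3F)) (Wedge.deg≡2 W₀) ⟩
      2 + deg G (u 3F)             ≡⟨ +-comm 2 (deg G (u 3F)) ⟩
      deg G (u 3F) + 2             ∎)
      where
      open ≡-Reasoning
      W₀ : Wedge (u 0F) (u 1F) (u 2F)
      W₀ = internal-wedge₀ I
      W₁ : Wedge (u 1F) (u 2F) (u 3F)
      W₁ = internal-wedge₁ I

    wedge-outer-deg-sum≡deg₀+2 : ∀ {m} {u : Seq G (3 + m)} → Internal (3 + m) u →
                                 ∀ {x w y} → Wedge x w y → deg G x + deg G y ≡ deg G (u 0F) + 2
    wedge-outer-deg-sum≡deg₀+2 {u = u} I W =
      trans (wedge-outer-deg-sum a b sat W (internal-wedge₀ I))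
            (cong (deg G (u 0F) +_) (Wedge.deg≡2 (internal-wedge₁ I)))

    internal-deg₀-agree : ∀ {m m′} {u : Seq G (3 + m)} {v : Seq G (3 + m′)} →
                          Internal (3 + m) u → Internal (3 + m′) v → deg G (v 0F) ≡ deg G (u 0F)
    internal-deg₀-agree {v = v} I J = +-cancelʳ-≡ 2 _ _
      (trans (cong (deg G (v 0F) +_) (sym (Wedge.deg≡2 (internal-wedge₁ J))))
             (wedge-outer-deg-sum≡deg₀+2 I (internal-wedge₀ J)))

    no-internal-2-path : ∀ {m} {u : Seq G (3 + m)} → Internal (3 + m) u →
                         ¬ (Σ (Seq G 2) λ v → IsInternalPath G 2 v ×
                              deg G (first G v) ≡ deg G (first G u) × deg G (last G v) ≡ deg G (first G u))
    no-internal-2-path {u = u} I (v , P , dv₀≡du₀ , dv₂≡du₀) =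
      internal-deg-first≢2 I (+-cancelˡ-≡ (deg G (u 0F)) _ _
        (trans (cong₂ _+_ (sym dv₀≡du₀) (sym dv₂≡du₀))
               (wedge-outer-deg-sum≡deg₀+2 I (internal-wedge₀ (inj₁ P)))))

    internal-deg₃-agree : ∀ {m m′} {u : Seq G (3 + m)} {v : Seq G (3 + m′)} →
                          Internal (3 + m) u → Internal (3 + m′) v → deg G (v 3F) ≡ deg G (u 0F)
    internal-deg₃-agree I J = trans (sym (internal-deg₀≡deg₃ J)) (internal-deg₀-agree I J)

    internal-length≤3 : ∀ {k u} → Internal k u → k ≤ 3
    internal-length≤3 {0} _ = z≤n
    internal-length≤3 {1} _ = s≤s z≤n
    internal-length≤3 {2} _ = s≤s (s≤s z≤n)
    internal-length≤3 {3} _ = s≤s (s≤s (s≤s z≤n))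
    internal-length≤3 {suc (suc (suc (suc m)))} I =
      ⊥-elim (internal-deg-first≢2 I (trans (internal-deg₀≡deg₃ I) (internal-interiorDeg2 I 3F z<s (s<s (s<s (s<s z<s))))))

lemma1p6 : (G : Graph) (a b : ℤ) → InClass G a b →
    (k : ℕ) (u : Seq G k) → IsInternalPath G k u ⊎ IsInternalCycle G k u →
    (k ≤ 3) ×
    (k ≡ 3 → ¬ (Σ (Seq G 2) λ v → IsInternalPath G 2 v ×
                   deg G (first G v) ≡ deg G (first G u) ×
                   deg G (last G v) ≡ deg G (first G u))) ×
    (k ≡ 3 → (deg G (first G u) ≡ deg G (last G u)) ×
             ((v : Seq G 3) → IsInternalPath G 3 v →
                (deg G (first G v) ≡ deg G (last G v)) ×
                (deg G (last G v) ≡ deg G (first G u)) ×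
                (deg G (first G u) ≡ deg G (last G u))))
lemma1p6 G a b (_ , _ , sat , _) k u I =
  internal-length≤3 G a b sat I ,
  (λ { refl → no-internal-2-path G a b sat I }) ,
  (λ { refl → internal-deg₀≡deg₃ G a b sat I ,
              λ v P → internal-deg₀≡deg₃ G a b sat (inj₁ P) ,
                      internal-deg₃-agree G a b sat I (inj₁ P) ,
                      internal-deg₀≡deg₃ G a b sat I })
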